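{- Let $\nu$ be a lattice path. For any two $\nu$-bracket vectors $b=(b_1,\dots,b_{\ell+1})$ and $b'=(b'_1,\dots,b'_{\ell+1})$, the componentwise minimum $(\min\{b_1,b'_1\},\dots,\min\{b_{\ell+1},b'_{\ell+1}\})$ is a $\nu$-bracket vector and it is the meet $b\wedge b'$ in the poset of $\nu$-bracket vectors ordered componentwise.
   Context: $\nu$ is a lattice path of unit north and east steps from $(0,0)$ to $(m,n)$, of length $\ell=m+n$. $b^{\min}$ lists the $y$-coordinates of the $\ell+1$ lattice points of $\nu$ in order along $\nu$; $f_k$ ($0\le k\le n$) is the position of the last occurrence of $k$ in $b^{\min}$. A $\nu$-bracket vector is an integer vector $b=(b_1,\dots,b_{\ell+1})$ with $b_{f_k}=k$ for $0\le k\le n$, $b^{\min}_i\le b_i\le n$ for all $i$, and no subsequence $(k,k',k)$ with $k<k'$. -}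

module Defs where

open import Data.Nat using (ℕ; zero; suc; _≤_; _<_; _⊓_)
open import Data.List using (List; []; _∷_; length)
open import Data.Vec using (Vec; []; _∷_; lookup; map; zipWith)
open import Data.Fin using (Fin; toℕ)
open import Data.Product using (_×_)
open import Relation.Binary.PropositionalEquality using (_≡_; _≢_)
open import Relation.Nullary using (¬_)

data Step : Set where
  N E : Step

-- A lattice path from (0,0) to (m,n) is a list of steps; ℓ = length.
LatticePath : Set
LatticePath = List Step

height : LatticePath → ℕ
height []       = 0
height (N ∷ ν) = suc (height ν)
height (E ∷ ν) = height ν

-- y-coordinates of the ℓ+1 lattice points of ν, in order along ν.
bmin : (ν : LatticePath) → Vec ℕ (suc (length ν))
bmin []       = 0 ∷ []
bmin (N ∷ ν) = 0 ∷ map suc (bmin ν)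
bmin (E ∷ ν) = 0 ∷ bmin ν

-- Index into vectors of length ℓ+1 (0-based; position i here is b_{i+1}).
Pos : LatticePath → Set
Pos ν = Fin (suc (length ν))

IsLastOcc : (ν : LatticePath) → ℕ → Pos ν → Set
IsLastOcc ν k i =
  (lookup (bmin ν) i ≡ k) × (∀ (j : Pos ν) → toℕ i < toℕ j → lookup (bmin ν) j ≢ k)

record IsBracketVector (ν : LatticePath) (b : Vec ℕ (suc (length ν))) : Set where
  field
    fixed   : ∀ (k : ℕ) → k ≤ height ν → ∀ (i : Pos ν) → IsLastOcc ν k i → lookup b i ≡ k
    lower   : ∀ (i : Pos ν) → lookup (bmin ν) i ≤ lookup b i
    upper   : ∀ (i : Pos ν) → lookup b i ≤ height ν
    avoid   : ∀ (i j l : Pos ν) → toℕ i < toℕ j → toℕ j < toℕ l →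
              ¬ ((lookup b i ≡ lookup b l) × (lookup b i < lookup b j))

_≤ᶜ_ : ∀ {n} → Vec ℕ n → Vec ℕ n → Set
b ≤ᶜ b' = ∀ i → lookup b i ≤ lookup b' i

cmin : ∀ {n} → Vec ℕ n → Vec ℕ n → Vec ℕ n
cmin = zipWith _⊓_

IsMeet : (ν : LatticePath) → (b b' m : Vec ℕ (suc (length ν))) → Set
IsMeet ν b b' m =
  IsBracketVector ν m × (m ≤ᶜ b) × (m ≤ᶜ b') ×
  (∀ c → IsBracketVector ν c → c ≤ᶜ b → c ≤ᶜ b' → c ≤ᶜ m)

-- Both vectors satisfy b_{f_k} = k, and bmin is weakly increasing with f_k the
-- last position where it equals k.  So if b_i = c_l = k with i < l, then
-- l ≤ f_k (after f_k every entry of any bracket vector exceeds k), and a larger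
-- entry b_j strictly between would give the forbidden pattern (k, b_j, k) at
-- positions i < j < f_k in b.  Since each entry of min(b, b') is an entry of b
-- or of b', a forbidden pattern in the minimum yields such a crossing pattern.
module Submission where

open import Defs
open import Data.List using ([]; _∷_; length)
open import Data.Nat using (ℕ; suc; _≤_; _<_; _⊓_; _≤?_; z≤n; s≤s)
open import Data.Nat.Properties
open import Data.Vec using (Vec; lookup; map)
open import Data.Vec.Properties using (lookup-zipWith; lookup-map)
open import Data.Fin using (toℕ) renaming (zero to fz; suc to fs)
open import Data.Product using (Σ-syntax; _×_; _,_)
open import Data.Sum using (inj₁; inj₂)
open import Relation.Nullary using (¬_; yes; no)
open import Relation.Binary.PropositionalEquality

bmin-monotone : (ν : LatticePath) (i j : Pos ν) → toℕ i ≤ toℕ j →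
                lookup (bmin ν) i ≤ lookup (bmin ν) j
bmin-monotone []      fz     fz     _       = z≤n
bmin-monotone (N ∷ ν) fz     _      _       = z≤n
bmin-monotone (E ∷ ν) fz     _      _       = z≤n
bmin-monotone (N ∷ ν) (fs i) (fs j) (s≤s p)
  rewrite lookup-map i suc (bmin ν) | lookup-map j suc (bmin ν) = s≤s (bmin-monotone ν i j p)
bmin-monotone (E ∷ ν) (fs i) (fs j) (s≤s p) = bmin-monotone ν i j p

lastOccurrence : (ν : LatticePath) (k : ℕ) → k ≤ height ν → Σ[ f ∈ Pos ν ] IsLastOcc ν k f
lastOccurrence []      0       _       = fz , refl , λ { fz () ; (fs ()) }
lastOccurrence (N ∷ ν) 0       _       = fz , refl , λ { fz () ; (fs j) _ → suc≢0 j }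
  where
  suc≢0 : ∀ j → lookup (map suc (bmin ν)) j ≢ 0
  suc≢0 j rewrite lookup-map j suc (bmin ν) = λ ()
lastOccurrence (N ∷ ν) (suc k) (s≤s k≤h) with lastOccurrence ν k k≤h
... | f , bf≡k , last = fs f , trans (lookup-map f suc (bmin ν)) (cong suc bf≡k) , later
  where
  later : ∀ j → toℕ (fs f) < toℕ j → lookup (bmin (N ∷ ν)) j ≢ suc k
  later (fs j) (s≤s f<j) rewrite lookup-map j suc (bmin ν) = λ e → last j f<j (suc-injective e)
lastOccurrence (E ∷ ν) k k≤h with lastOccurrence ν k k≤h
... | f , bf≡k , last = fs f , bf≡k , λ { fz () ; (fs j) (s≤s f<j) → last j f<j }

bmin-beyond-lastOcc : ∀ ν {k f l} → IsLastOcc ν k f → toℕ f < toℕ l → k < lookup (bmin ν) l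
bmin-beyond-lastOcc ν {f = f} {l} (bf≡k , last) f<l =
  ≤∧≢⇒< (subst (_≤ lookup (bmin ν) l) bf≡k (bmin-monotone ν f l (<⇒≤ f<l)))
        (λ k≡bl → last l f<l (sym k≡bl))

module _ {ν : LatticePath} where
  open IsBracketVector

  no-crossing-pattern : ∀ {b c} → IsBracketVector ν b → IsBracketVector ν c →
                        ∀ {i j l} → toℕ i < toℕ j → toℕ j < toℕ l →
                        lookup b i ≡ lookup c l → ¬ (lookup b i < lookup b j)
  no-crossing-pattern {b} B C {i} {j} {l} i<j j<l bi≡cl bi<bj
    with lastOccurrence ν (lookup b i) (upper B i)
  ... | f , occ with toℕ l ≤? toℕ f
  ... | yes l≤f = avoid B i j f i<j (<-≤-trans j<l l≤f)
                    (sym (fixed B _ (upper B i) f occ) , bi<bj)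
  ... | no l≰f  = <⇒≱ (bmin-beyond-lastOcc ν occ (≰⇒> l≰f))
                    (subst (lookup (bmin ν) l ≤_) (sym bi≡cl) (lower C l))

module _ {n : ℕ} (b b' : Vec ℕ n) where

  cmin-≤ᶜˡ : cmin b b' ≤ᶜ b
  cmin-≤ᶜˡ i rewrite lookup-zipWith _⊓_ i b b' = m⊓n≤m _ _

  cmin-≤ᶜʳ : cmin b b' ≤ᶜ b'
  cmin-≤ᶜʳ i rewrite lookup-zipWith _⊓_ i b b' = m⊓n≤n _ _

  cmin-greatest : ∀ {c} → c ≤ᶜ b → c ≤ᶜ b' → c ≤ᶜ cmin b b'
  cmin-greatest c≤b c≤b' i rewrite lookup-zipWith _⊓_ i b b' = ⊓-glb (c≤b i) (c≤b' i)

module _ {ν : LatticePath} {b b' : Vec ℕ (suc (length ν))}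
         (B : IsBracketVector ν b) (B' : IsBracketVector ν b') where
  open IsBracketVector

  cmin-attained : ∀ i → Σ[ c ∈ Vec ℕ (suc (length ν)) ]
                  IsBracketVector ν c × (lookup c i ≡ lookup (cmin b b') i) × (cmin b b' ≤ᶜ c)
  cmin-attained i with ⊓-sel (lookup b i) (lookup b' i)
  ... | inj₁ m≡b = b  , B  , trans (sym m≡b) (sym (lookup-zipWith _⊓_ i b b')) , cmin-≤ᶜˡ b b'
  ... | inj₂ m≡b' = b' , B' , trans (sym m≡b') (sym (lookup-zipWith _⊓_ i b b')) , cmin-≤ᶜʳ b b'

  cmin-isBracketVector : IsBracketVector ν (cmin b b')
  fixed cmin-isBracketVector k k≤h i occ rewrite lookup-zipWith _⊓_ i b b'
                                               | fixed B k k≤h i occ | fixed B' k k≤h i occ = ⊓-idem k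
  lower cmin-isBracketVector i rewrite lookup-zipWith _⊓_ i b b' = ⊓-glb (lower B i) (lower B' i)
  upper cmin-isBracketVector i = ≤-trans (cmin-≤ᶜˡ b b' i) (upper B i)
  avoid cmin-isBracketVector i j l i<j j<l (mi≡ml , mi<mj)
    with cmin-attained i | cmin-attained l
  ... | c , C , ci≡mi , m≤c | d , D , dl≡ml , _ =
    no-crossing-pattern C D i<j j<l (trans ci≡mi (trans mi≡ml (sym dl≡ml)))
      (subst (_< lookup c j) (sym ci≡mi) (<-≤-trans mi<mj (m≤c j)))

proposition4p12 : (ν : LatticePath) → (b b' : Vec ℕ (suc (length ν))) →
                  IsBracketVector ν b → IsBracketVector ν b' →
                  IsMeet ν b b' (cmin b b')
proposition4p12 ν b b' B B' =
  cmin-isBracketVector B B' , cmin-≤ᶜˡ b b' , cmin-≤ᶜʳ b b' ,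
  λ c _ → cmin-greatest b b' {c}
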